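{- For any integers $\delta,k\ge 2$ there is a bipartite graph $G=(A\cup B,E)$ whose part $A$ has maximum degree $k$ and whose part $B$ has maximum degree $f(\delta,k)$, where $f(\delta,k)<\delta^k$ and moreover $f(\delta,k)\le\sum_{i=1}^{\delta}i^{k-1}$, such that $G$ is not $(k,\delta)$-choosable.
   Context: For a bipartite graph $G=(A\cup B,E)$ with designated parts $A,B$, a $(k_A,k_B)$-list-assignment assigns to each vertex of $A$ a set of $k_A$ positive integers and to each vertex of $B$ a set of $k_B$ positive integers; $G$ is $(k_A,k_B)$-choosable if for every such assignment $L$ there is a proper colouring $c$ with $c(v)\in L(v)$ for all $v$. -}

module Defs where

open import Data.Nat using (ℕ; zero; suc; _+_; _^_; _≤_; _<_)
open import Data.Bool using (Bool; true; false; if_then_else_)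
open import Data.Fin using (Fin)
open import Data.List using (List; map)
open import Data.Nat.ListAction using (sum)
open import Data.List using () renaming (allFin to allFinL)
open import Data.Product using (Σ; ∃; _×_; _,_)
open import Relation.Binary.PropositionalEquality using (_≡_; _≢_)

-- A finite bipartite graph with designated parts A = Fin m and B = Fin n,
-- given by its (decidable) bipartite adjacency: adj a b = true iff ab ∈ E.
record BipartiteGraph : Set where
  field
    m   : ℕ
    n   : ℕ
    adj : Fin m → Fin n → Bool
open BipartiteGraph public

indicator : Bool → ℕ
indicator true  = 1
indicator false = 0

degA : (G : BipartiteGraph) → Fin (m G) → ℕ
degA G a = sum (map (λ b → indicator (adj G a b)) (allFinL (n G)))

degB : (G : BipartiteGraph) → Fin (n G) → ℕ
degB G b = sum (map (λ a → indicator (adj G a b)) (allFinL (m G)))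

MaxDegA : BipartiteGraph → ℕ → Set
MaxDegA G d = (∀ a → degA G a ≤ d) × ∃ λ a → degA G a ≡ d

MaxDegB : BipartiteGraph → ℕ → Set
MaxDegB G d = (∀ b → degB G b ≤ d) × ∃ λ b → degB G b ≡ d

record KSet (k : ℕ) : Set where
  field
    elem      : Fin k → ℕ
    injective : ∀ i j → elem i ≡ elem j → i ≡ j
    positive  : ∀ i → 0 < elem i
open KSet public

_∈ₖ_ : {k : ℕ} → ℕ → KSet k → Set
x ∈ₖ S = ∃ λ i → elem S i ≡ x

record ListAssignment (G : BipartiteGraph) (kA kB : ℕ) : Set where
  field
    LA : Fin (m G) → KSet kA
    LB : Fin (n G) → KSet kB
open ListAssignment public

record ProperLColouring (G : BipartiteGraph) {kA kB : ℕ}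
                        (L : ListAssignment G kA kB) : Set where
  field
    cA     : Fin (m G) → ℕ
    cB     : Fin (n G) → ℕ
    inLA   : ∀ a → cA a ∈ₖ LA L a
    inLB   : ∀ b → cB b ∈ₖ LB L b
    proper : ∀ a b → adj G a b ≡ true → cA a ≢ cB b

Choosable : BipartiteGraph → ℕ → ℕ → Set
Choosable G kA kB = (L : ListAssignment G kA kB) → ProperLColouring G L

powSum : ℕ → ℕ → ℕ
powSum zero    e = 0
powSum (suc d) e = powSum d e + suc d ^ e

module Submission where

-- Proposition 8.1.  Write k = e + 1.  We build graphs G₀, G₁, … with lists
-- of size k on A and size d on B in G_d.  G₀ is one B-vertex with the empty
-- list; G_{d+1} arises from G_d by
--   * splitting each B-vertex v into (v,0),…,(v,e): the copy (v,0) keeps the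
--     A-neighbours of v and gets the list {z_d} ∪ L(v) for a new colour z_d,
--     while (v,t+1) gets a private list {x_{i,t} : i ≤ d};
--   * adding, for each v and each c : Fin e → Fin (d+1), a gadget A-vertex
--     joined to (v,0),…,(v,e) with list {z_d} ∪ {x_{c(t),t} : t < e}.
-- If a colouring gives some (v,0) the colour z_d, the private vertices choose
-- a function c and the gadget for (v,c) sees all its colours; otherwise every
-- (v,0) uses L(v), which colours G_d.  So no G_d is colourable.  Counting
-- degrees, A-vertices have degree k and B-degrees are at most Σ_{i≤d} i^e,
-- attained at the root.

open import Defs
open import Data.Nat using (ℕ; zero; suc; _+_; _*_; _^_; _∸_; _≤_; _<_; z≤n; s≤s)
open import Data.Nat.Properties hiding (_≟_)
open import Data.Bool using (Bool; true; false)
open import Data.Fin using (Fin; zero; suc; toℕ; _↑ˡ_; _↑ʳ_; splitAt; combine; remQuot;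
  punchIn; punchOut; finToFun; funToFin)
open import Data.Fin.Properties using (splitAt-↑ˡ; splitAt-↑ʳ; remQuot-combine; combine-injective;
  toℕ-injective; punchInᵢ≢i; punchIn-punchOut; finToFun-funToFin; any?; _≟_)
open import Data.Vec.Functional using (Vector; _∷_)
open import Data.List using (map; tabulate; allFin)
open import Data.List.Properties using (map-tabulate)
import Data.Nat.ListAction as List
open import Data.Product using (Σ; ∃; _×_; _,_; proj₁; proj₂)
open import Data.Sum using (_⊎_; inj₁; inj₂)
open import Data.Empty using (⊥; ⊥-elim)
open import Function.Base using (_∘_)
open import Function.Definitions using (Injective)
open import Relation.Nullary using (¬_; yes; no; does)
open import Relation.Nullary.Decidable using (dec-true; dec-false)
open import Relation.Binary.PropositionalEquality
open import Algebra.Properties.CommutativeMonoid.Sum +-0-commutativeMonoid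
  using (sum-syntax; sum-cong-≗; sum-remove; sum-replicate-zero)
  renaming (sum to ∑)

list-sum-allFin : ∀ n (f : Fin n → ℕ) → List.sum (map f (allFin n)) ≡ ∑ f
list-sum-allFin n f = trans (cong List.sum (map-tabulate (λ i → i) f)) (tabulate-sum n f)
  where
  tabulate-sum : ∀ n (f : Fin n → ℕ) → List.sum (tabulate f) ≡ ∑ f
  tabulate-sum zero    f = refl
  tabulate-sum (suc n) f = cong (f zero +_) (tabulate-sum n (λ i → f (suc i)))

∑-ones : ∀ n → ∑[ i < n ] 1 ≡ n
∑-ones zero    = refl
∑-ones (suc n) = cong suc (∑-ones n)

∑-concentrated : ∀ n (f : Fin n → ℕ) (p : Fin n) → (∀ i → i ≢ p → f i ≡ 0) → ∑ f ≡ f p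
∑-concentrated (suc n) f p vanish = begin
  ∑ f                                 ≡⟨ sum-remove {i = p} f ⟩
  f p + ∑[ j < n ] f (punchIn p j)    ≡⟨ cong (f p +_) (sum-cong-≗ (λ j →
                                           vanish _ (punchInᵢ≢i p j))) ⟩
  f p + ∑[ j < n ] 0                  ≡⟨ cong (f p +_) (sum-replicate-zero n) ⟩
  f p + 0                             ≡⟨ +-identityʳ (f p) ⟩
  f p                                 ∎
  where open ≡-Reasoning

∑-+ : ∀ m {n} (f : Fin (m + n) → ℕ) → ∑ f ≡ ∑[ i < m ] f (i ↑ˡ n) + ∑[ j < n ] f (m ↑ʳ j)
∑-+ zero    f = refl
∑-+ (suc m) f = trans (cong (f zero +_) (∑-+ m (λ i → f (suc i)))) (sym (+-assoc (f zero) _ _))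

∑-combine : ∀ m {n} (f : Fin (m * n) → ℕ) → ∑ f ≡ ∑[ i < m ] ∑[ j < n ] f (combine i j)
∑-combine zero        f = refl
∑-combine (suc m) {n} f =
  trans (∑-+ n f) (cong (∑[ j < n ] f (j ↑ˡ m * n) +_) (∑-combine m (λ x → f (n ↑ʳ x))))

∑-splitAt : ∀ m {n} (h : Fin m ⊎ Fin n → ℕ) →
  ∑[ x < m + n ] h (splitAt m x) ≡ ∑[ i < m ] h (inj₁ i) + ∑[ j < n ] h (inj₂ j)
∑-splitAt m {n} h = trans (∑-+ m _) (cong₂ _+_
  (sum-cong-≗ (λ i → cong h (splitAt-↑ˡ m i n)))
  (sum-cong-≗ (λ j → cong h (splitAt-↑ʳ m n j))))

∑-remQuot : ∀ m {n} (h : Fin m × Fin n → ℕ) →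
  ∑[ x < m * n ] h (remQuot n x) ≡ ∑[ i < m ] ∑[ j < n ] h (i , j)
∑-remQuot m h = trans (∑-combine m _)
  (sum-cong-≗ (λ i → sum-cong-≗ (λ j → cong h (remQuot-combine i j))))

∑-block : ∀ n m (p : Fin n) (P : Fin n → Bool) →
  P p ≡ true → (∀ v → v ≢ p → P v ≡ false) → ∑[ v < n ] ∑[ s < m ] indicator (P v) ≡ m
∑-block n m p P at-p off-p = begin
  ∑[ v < n ] ∑[ s < m ] indicator (P v)  ≡⟨ ∑-concentrated n _ p vanish ⟩
  ∑[ s < m ] indicator (P p)             ≡⟨ cong (λ b → ∑[ s < m ] indicator b) at-p ⟩
  ∑[ s < m ] 1                           ≡⟨ ∑-ones m ⟩
  m                                      ∎
  where
  open ≡-Reasoning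
  vanish : ∀ v → v ≢ p → ∑[ s < m ] indicator (P v) ≡ 0
  vanish v v≢p =
    trans (cong (λ b → ∑[ s < m ] indicator b) (off-p v v≢p)) (sum-replicate-zero m)

-- Colours and lists
-- Level colours z_d and private colours x_n, coded injectively as positive
-- integers (odd and even respectively).
data Colour : Set where
  level   : ℕ → Colour
  private′ : ℕ → Colour

code : Colour → ℕ
code (level d)    = suc (2 * d)
code (private′ n) = 2 * suc n

code-positive : ∀ c → 0 < code c
code-positive (level _)    = s≤s z≤n
code-positive (private′ _) = s≤s z≤n

code-injective : Injective _≡_ _≡_ code
code-injective {level d}    {level d′}    eq = cong level (*-cancelˡ-≡ d d′ 2 (suc-injective eq))
code-injective {level d}    {private′ n′} eq = ⊥-elim (even≢odd (suc n′) d (sym eq))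
code-injective {private′ n} {level d′}    eq = ⊥-elim (even≢odd (suc n) d′ eq)
code-injective {private′ n} {private′ n′} eq =
  cong private′ (suc-injective (*-cancelˡ-≡ (suc n) (suc n′) 2 eq))

x[_,_] : ∀ {d e} → Fin (suc d) → Fin e → Colour
x[ i , t ] = private′ (toℕ (combine i t))

x-injective : ∀ {d e} (i i′ : Fin (suc d)) (t t′ : Fin e) →
  x[ i , t ] ≡ x[ i′ , t′ ] → i ≡ i′ × t ≡ t′
x-injective i i′ t t′ eq = combine-injective i t i′ t′ (toℕ-injective (private-injective eq))
  where
  private-injective : ∀ {n n′} → private′ n ≡ private′ n′ → n ≡ n′
  private-injective refl = refl

toKSet : ∀ {n} (xs : Vector Colour n) → Injective _≡_ _≡_ xs → KSet n
toKSet xs distinct = record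
  { elem      = λ i → code (xs i)
  ; injective = λ i j eq → distinct (code-injective eq)
  ; positive  = λ i → code-positive (xs i)
  }

∷-injective : ∀ {A : Set} {n} {x : A} {xs : Vector A n} →
  (∀ i → xs i ≢ x) → Injective _≡_ _≡_ xs → Injective _≡_ _≡_ (x ∷ xs)
∷-injective new distinct {zero}  {zero}  eq = refl
∷-injective new distinct {zero}  {suc j} eq = ⊥-elim (new j (sym eq))
∷-injective new distinct {suc i} {zero}  eq = ⊥-elim (new i eq)
∷-injective new distinct {suc i} {suc j} eq = cong suc (distinct eq)

-- The graphs G_d with their lists, for A-lists of size k = e + 1
module Construction (e : ℕ) where

  k : ℕ
  k = suc e

  -- gadgets d counts the functions Fin e → Fin (d + 1)
  gadgets : ℕ → ℕ
  gadgets d = suc d ^ e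

  nB : ℕ → ℕ
  nB zero    = 1
  nB (suc d) = nB d * k

  nA : ℕ → ℕ
  nA zero    = 0
  nA (suc d) = nA d + nB d * gadgets d

  -- A-vertices of G_{d+1} are old A-vertices or gadgets (base vertex, function);
  -- B-vertices of G_{d+1} are pairs (v , t) with v a B-vertex of G_d.
  NewA NewB : ℕ → Set
  NewA d = Fin (nA d) ⊎ Fin (nB d * gadgets d)
  NewB d = Fin (nB d) × Fin k

  -- a gadget index encodes its base vertex and its function
  base : ∀ d → Fin (nB d * gadgets d) → Fin (nB d)
  base d g = proj₁ (remQuot {nB d} (gadgets d) g)

  choice : ∀ d → Fin (nB d * gadgets d) → Fin e → Fin (suc d)
  choice d g = finToFun {suc d} {e} (proj₂ (remQuot {nB d} (gadgets d) g))

  stepAdj : ∀ d → (Fin (nA d) → Fin (nB d) → Bool) → NewA d → NewB d → Bool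
  stepAdj d adj (inj₁ a) (v , zero)  = adj a v
  stepAdj d adj (inj₁ a) (v , suc _) = false
  stepAdj d adj (inj₂ g) (v , _)     = does (base d g ≟ v)

  adjacency : ∀ d → Fin (nA d) → Fin (nB d) → Bool
  adjacency zero    ()
  adjacency (suc d) a b = stepAdj d (adjacency d) (splitAt (nA d) a) (remQuot {nB d} k b)

  stepListA : ∀ d → (Fin (nA d) → Vector Colour k) → NewA d → Vector Colour k
  stepListA d L (inj₁ a) = L a
  stepListA d L (inj₂ g) = level d ∷ λ t → x[ choice d g t , t ]

  listA : ∀ d → Fin (nA d) → Vector Colour k
  listA zero    ()
  listA (suc d) a = stepListA d (listA d) (splitAt (nA d) a)

  stepListB : ∀ d → (Fin (nB d) → Vector Colour d) → NewB d → Vector Colour (suc d)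
  stepListB d L (v , zero)  = level d ∷ L v
  stepListB d L (v , suc t) = λ i → x[ i , t ]

  listB : ∀ d → Fin (nB d) → Vector Colour d
  listB zero    _ ()
  listB (suc d) b = stepListB d (listB d) (remQuot {nB d} k b)

  copy : ∀ d → Fin (nB d) → Fin (nB (suc d))
  copy d v = combine v zero

  gadget : ∀ d → Fin (nB d) → (Fin e → Fin (suc d)) → Fin (nA (suc d))
  gadget d v c = nA d ↑ʳ combine v (funToFin c)

  adjacency-old : ∀ d a v →
    adjacency (suc d) (a ↑ˡ nB d * gadgets d) (copy d v) ≡ adjacency d a v
  adjacency-old d a v =
    cong₂ (stepAdj d (adjacency d)) (splitAt-↑ˡ (nA d) a _) (remQuot-combine v zero)

  adjacency-gadget : ∀ d v c s → adjacency (suc d) (gadget d v c) (combine v s) ≡ true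
  adjacency-gadget d v c s = trans
    (cong₂ (stepAdj d (adjacency d)) (splitAt-↑ʳ (nA d) _ g) (remQuot-combine v s))
    (dec-true (base d g ≟ v) (cong proj₁ (remQuot-combine v (funToFin c))))
    where g = combine v (funToFin c)

  listA-old : ∀ d a → listA (suc d) (a ↑ˡ nB d * gadgets d) ≡ listA d a
  listA-old d a = cong (stepListA d (listA d)) (splitAt-↑ˡ (nA d) a _)

  listA-gadget : ∀ d v c i →
    listA (suc d) (gadget d v c) i ≡ (level d ∷ λ t → x[ c t , t ]) i
  listA-gadget d v c i =
    trans (cong (λ x → stepListA d (listA d) x i) (splitAt-↑ʳ (nA d) _ g)) (gadget-list i)
    where
    g = combine v (funToFin c)
    gadget-list : ∀ i → stepListA d (listA d) (inj₂ g) i ≡ (level d ∷ λ t → x[ c t , t ]) i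
    gadget-list zero    = refl
    gadget-list (suc t) = cong (λ j → x[ j , t ]) (trans
      (cong (λ y → finToFun {suc d} {e} (proj₂ y) t) (remQuot-combine v (funToFin c)))
      (finToFun-funToFin c t))

  listB-copy : ∀ d v → listB (suc d) (copy d v) ≡ level d ∷ listB d v
  listB-copy d v = cong (stepListB d (listB d)) (remQuot-combine v zero)

  listB-private : ∀ d v t → listB (suc d) (combine v (suc t)) ≡ λ i → x[ i , t ]
  listB-private d v t = cong (stepListB d (listB d)) (remQuot-combine v (suc t))

  -- Every A-list and B-list is repetition-free.  For B-lists this needs the
  -- invariant that the level colours in lists of G_d are among z_0,…,z_{d-1}.
  listA-injective : ∀ d a → Injective _≡_ _≡_ (listA d a)
  listA-injective (suc d) a = step (splitAt (nA d) a)
    where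
    step : ∀ x → Injective _≡_ _≡_ (stepListA d (listA d) x)
    step (inj₁ a′) = listA-injective d a′
    step (inj₂ g)  = ∷-injective (λ t ())
      (λ {t} {t′} eq → proj₂ (x-injective (choice d g t) (choice d g t′) t t′ eq))

  listB-levels : ∀ d b i {j} → listB d b i ≡ level j → j < d
  listB-levels (suc d) b = step (remQuot {nB d} k b)
    where
    step : ∀ r i {j} → stepListB d (listB d) r i ≡ level j → j < suc d
    step (v , zero)  zero    refl = n<1+n d
    step (v , zero)  (suc i) eq   = m<n⇒m<1+n (listB-levels d v i eq)
    step (v , suc t) i       ()

  listB-injective : ∀ d b → Injective _≡_ _≡_ (listB d b)
  listB-injective zero    b {()}
  listB-injective (suc d) b = step (remQuot {nB d} k b)
    where
    step : ∀ r → Injective _≡_ _≡_ (stepListB d (listB d) r)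
    step (v , zero)  =
      ∷-injective (λ i eq → <-irrefl refl (listB-levels d v i eq)) (listB-injective d v)
    step (v , suc t) {i} {i′} eq = proj₁ (x-injective i i′ t t eq)

  degreeA : ∀ d → Fin (nA d) → ℕ
  degreeA d a = ∑[ b < nB d ] indicator (adjacency d a b)

  degreeB : ∀ d → Fin (nB d) → ℕ
  degreeB d b = ∑[ a < nA d ] indicator (adjacency d a b)

  -- Old A-vertices are joined only to the copies (v,0); gadgets to one block
  -- {v} × Fin k.  Hence every A-vertex has degree k.
  degreeA-exact : ∀ d a → degreeA d a ≡ k
  degreeA-exact (suc d) a =
    trans (∑-remQuot (nB d) (indicator ∘ stepAdj d (adjacency d) x)) (new-degree x)
    where
    x = splitAt (nA d) a
    new-degree : ∀ x → ∑[ v < nB d ] ∑[ s < k ] indicator (stepAdj d (adjacency d) x (v , s)) ≡ k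
    new-degree (inj₁ a′) = trans (sum-cong-≗ only-copy) (degreeA-exact d a′)
      where
      only-copy : ∀ v → ∑[ s < k ] indicator (stepAdj d (adjacency d) (inj₁ a′) (v , s))
                      ≡ indicator (adjacency d a′ v)
      only-copy v =
        trans (cong (indicator (adjacency d a′ v) +_) (sum-replicate-zero e)) (+-identityʳ _)
    new-degree (inj₂ g) = ∑-block (nB d) k (base d g) (λ v → does (base d g ≟ v))
      (dec-true (base d g ≟ base d g) refl)
      (λ v v≢p → dec-false (base d g ≟ v) (λ eq → v≢p (sym eq)))

  -- A B-vertex (v , t) of G_{d+1} inherits the degree of v when t = 0, and
  -- gains one neighbour for each of the gadgets d gadgets based at v.
  inherited : ∀ d → NewB d → ℕ
  inherited d (v , zero)  = degreeB d v
  inherited d (v , suc _) = 0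

  degreeB-step : ∀ d b → degreeB (suc d) b ≡ inherited d (remQuot {nB d} k b) + gadgets d
  degreeB-step d b =
    trans (∑-splitAt (nA d) (λ x → indicator (stepAdj d (adjacency d) x r)))
          (cong₂ _+_ (from-old r) (from-gadgets r))
    where
    r = remQuot {nB d} k b
    from-old : ∀ r → ∑[ a < nA d ] indicator (stepAdj d (adjacency d) (inj₁ a) r) ≡ inherited d r
    from-old (v , zero)  = refl
    from-old (v , suc _) = sum-replicate-zero (nA d)
    from-gadgets : ∀ r →
      ∑[ g < nB d * gadgets d ] indicator (stepAdj d (adjacency d) (inj₂ g) r) ≡ gadgets d
    from-gadgets (v , _) = trans (∑-remQuot (nB d) (λ pc → indicator (does (proj₁ pc ≟ v))))
      (∑-block (nB d) (gadgets d) v (λ p → does (p ≟ v))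
        (dec-true (v ≟ v) refl) (λ p → dec-false (p ≟ v)))

  degreeB-bound : ∀ d b → degreeB d b ≤ powSum d e
  degreeB-bound zero    b = z≤n
  degreeB-bound (suc d) b =
    ≤-trans (≤-reflexive (degreeB-step d b))
            (+-monoˡ-≤ (gadgets d) (inherited-bound (remQuot {nB d} k b)))
    where
    inherited-bound : ∀ r → inherited d r ≤ powSum d e
    inherited-bound (v , zero)  = degreeB-bound d v
    inherited-bound (v , suc _) = z≤n

  root : ∀ d → Fin (nB d)
  root zero    = zero
  root (suc d) = copy d (root d)

  degreeB-root : ∀ d → degreeB d (root d) ≡ powSum d e
  degreeB-root zero    = refl
  degreeB-root (suc d) = begin
    degreeB (suc d) (root (suc d))
      ≡⟨ degreeB-step d (root (suc d)) ⟩
    inherited d (remQuot {nB d} k (root (suc d))) + gadgets d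
      ≡⟨ cong (λ r → inherited d r + gadgets d) (remQuot-combine (root d) zero) ⟩
    degreeB d (root d) + gadgets d
      ≡⟨ cong (_+ gadgets d) (degreeB-root d) ⟩
    powSum (suc d) e
      ∎
    where open ≡-Reasoning

  -- A colouring of G_d from its lists, recorded by the chosen list positions.
  record Colouring (d : ℕ) : Set where
    field
      pickA  : Fin (nA d) → Fin k
      pickB  : Fin (nB d) → Fin d
      proper : ∀ a b → adjacency d a b ≡ true → listA d a (pickA a) ≢ listB d b (pickB b)
  open Colouring

  -- If a copy (v,0) takes the new colour z_d, the private vertices (v,t+1)
  -- select a function c, and every colour of the gadget for (v,c) appears on
  -- one of its neighbours.
  gadget-blocked : ∀ {d} (col : Colouring (suc d)) v → pickB col (copy d v) ≡ zero → ⊥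
  gadget-blocked {d} col v copy-takes-z =
    proper col a (combine v s) (adjacency-gadget d v c s) same-colour
    where
    c : Fin e → Fin (suc d)
    c t = pickB col (combine v (suc t))
    a = gadget d v c
    colour-of-neighbour : ∀ s → Colour
    colour-of-neighbour s = listB (suc d) (combine v s) (pickB col (combine v s))
    sees-every-colour : ∀ i → ∃ λ s → listA (suc d) a i ≡ colour-of-neighbour s
    sees-every-colour zero    = zero , trans (listA-gadget d v c zero) (sym (trans
      (cong (listB (suc d) (copy d v)) copy-takes-z)
      (cong (λ L → L zero) (listB-copy d v))))
    sees-every-colour (suc t) = suc t , trans (listA-gadget d v c (suc t))
      (sym (cong (λ L → L (c t)) (listB-private d v t)))
    s = proj₁ (sees-every-colour (pickA col a))
    same-colour = proj₂ (sees-every-colour (pickA col a))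

  -- Otherwise every copy (v,0) uses a colour of L(v), so restricting to the
  -- old A-vertices and the copies colours G_d.
  restrict : ∀ {d} (col : Colouring (suc d)) →
    (∀ v → zero ≢ pickB col (copy d v)) → Colouring d
  restrict {d} col avoids-z = record
    { pickA  = λ a → pickA col (old a)
    ; pickB  = λ v → punchOut (avoids-z v)
    ; proper = λ a v adj eq →
        proper col (old a) (copy d v) (trans (adjacency-old d a v) adj) (same-colour a v eq)
    }
    where
    old : Fin (nA d) → Fin (nA (suc d))
    old a = a ↑ˡ nB d * gadgets d
    same-colour : ∀ a v → listA d a (pickA col (old a)) ≡ listB d v (punchOut (avoids-z v)) →
      listA (suc d) (old a) (pickA col (old a)) ≡ listB (suc d) (copy d v) (pickB col (copy d v))
    same-colour a v eq = begin
      listA (suc d) (old a) (pickA col (old a))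
        ≡⟨ cong (λ L → L (pickA col (old a))) (listA-old d a) ⟩
      listA d a (pickA col (old a))
        ≡⟨ eq ⟩
      (level d ∷ listB d v) (suc (punchOut (avoids-z v)))
        ≡⟨ cong (level d ∷ listB d v) (punchIn-punchOut (avoids-z v)) ⟩
      (level d ∷ listB d v) (pickB col (copy d v))
        ≡⟨ cong (λ L → L (pickB col (copy d v))) (listB-copy d v) ⟨
      listB (suc d) (copy d v) (pickB col (copy d v))
        ∎
      where open ≡-Reasoning

  -- By induction on d: G₀ has a vertex with an empty list.
  no-colouring : ∀ d → ¬ Colouring d
  no-colouring zero    col with pickB col zero
  ... | ()
  no-colouring (suc d) col with any? (λ v → pickB col (copy d v) ≟ zero)
  ... | yes (v , copy-takes-z) = gadget-blocked col v copy-takes-z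
  ... | no no-copy-takes-z     =
    no-colouring d (restrict col (λ v z → no-copy-takes-z (v , sym z)))

  graph : ℕ → BipartiteGraph
  graph d = record { m = nA d ; n = nB d ; adj = adjacency d }

  lists : ∀ d → ListAssignment (graph d) k d
  lists d = record
    { LA = λ a → toKSet (listA d a) (listA-injective d a)
    ; LB = λ b → toKSet (listB d b) (listB-injective d b)
    }

  not-choosable : ∀ d → ¬ Choosable (graph d) k d
  not-choosable d choose = no-colouring d (record
    { pickA  = λ a → proj₁ (inLA col a)
    ; pickB  = λ b → proj₁ (inLB col b)
    ; proper = λ a b adj eq → ProperLColouring.proper col a b adj
        (trans (sym (proj₂ (inLA col a))) (trans (cong code eq) (proj₂ (inLB col b))))
    })
    where
    col = choose (lists d)
    open ProperLColouring

  maxDegA : ∀ d → MaxDegA (graph (suc d)) k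
  maxDegA d = (λ a → ≤-reflexive (degree-is-k a))
            , gadget d (root d) (λ _ → zero) , degree-is-k _
    where
    degree-is-k : ∀ a → degA (graph (suc d)) a ≡ k
    degree-is-k a = trans (list-sum-allFin (nB (suc d)) _) (degreeA-exact (suc d) a)

  maxDegB : ∀ d → MaxDegB (graph d) (powSum d e)
  maxDegB d = (λ b → ≤-trans (≤-reflexive (degree-is-sum b)) (degreeB-bound d b))
            , root d , trans (degree-is-sum (root d)) (degreeB-root d)
    where
    degree-is-sum : ∀ b → degB (graph d) b ≡ degreeB d b
    degree-is-sum b = list-sum-allFin (nA d) (λ a → indicator (adjacency d a b))

-- Arithmetic: Σ_{i=1}^{δ} i^e < δ^(e+1) for δ ≥ 2, e ≥ 1
-- each of the d terms is at most d^e
powSum-≤ : ∀ d e → powSum d e ≤ d * d ^ e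
powSum-≤ zero    e = z≤n
powSum-≤ (suc d) e = begin
  powSum d e + suc d ^ e      ≤⟨ +-monoˡ-≤ (suc d ^ e) (powSum-≤ d e) ⟩
  d * d ^ e + suc d ^ e       ≤⟨ +-monoˡ-≤ (suc d ^ e) (*-monoʳ-≤ d (^-monoˡ-≤ e (n≤1+n d))) ⟩
  d * suc d ^ e + suc d ^ e   ≡⟨ +-comm (d * suc d ^ e) (suc d ^ e) ⟩
  suc d * suc d ^ e           ∎
  where open ≤-Reasoning

-- the terms i^e with i < δ are strictly below δ^e, and there is at least one
powSum-< : ∀ d e → powSum (suc (suc d)) (suc e) < suc (suc d) ^ suc (suc e)
powSum-< d e = begin-strict
  powSum (suc d) (suc e) + δ ^ suc e     ≤⟨ +-monoˡ-≤ (δ ^ suc e) (powSum-≤ (suc d) (suc e)) ⟩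
  suc d * suc d ^ suc e + δ ^ suc e      <⟨ +-monoˡ-< (δ ^ suc e)
                                              (*-monoʳ-< (suc d) (^-monoˡ-< (suc e) (n<1+n (suc d)))) ⟩
  suc d * δ ^ suc e + δ ^ suc e          ≡⟨ +-comm (suc d * δ ^ suc e) (δ ^ suc e) ⟩
  δ ^ suc (suc e)                        ∎
  where
  δ = suc (suc d)
  open ≤-Reasoning

proposition8p1 : (δ k : ℕ) → 2 ≤ δ → 2 ≤ k →
    Σ ℕ λ f → (f < δ ^ k) × (f ≤ powSum δ (k ∸ 1)) ×
      Σ BipartiteGraph λ G → MaxDegA G k × MaxDegB G f × ¬ Choosable G k δ
proposition8p1 (suc (suc d)) (suc (suc e)) (s≤s (s≤s z≤n)) (s≤s (s≤s z≤n)) =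
  powSum δ (suc e) , powSum-< d e , ≤-refl ,
  graph δ , maxDegA (suc d) , maxDegB δ , not-choosable δ
  where
  open Construction (suc e)
  δ = suc (suc d)
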